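{- Let $\mathbf{M}=\langle\mathbf{H},\square,\Diamond\rangle$ be a modal Heyting algebra and $F\subseteq H$ a Boolean filter such that if $a\wedge b=\bot$ and $a\vee b\in F$ then $\square a\vee\Diamond b\in F$. Consider the modal Nelson lattice $\mathbf{N}(\mathbf{M},F)$. Then $\mathbf{M}$ is isomorphic to $\mathbf{M}^*_{\mathbf{N}(\mathbf{M},F)}=\langle\mathbf{H}^*,\square^*,\Diamond^*\rangle$ via $h\colon H\to H^*$, $h(a)=(a,-a)$, and moreover $h[F]=F^*$.
   Context: A modal Heyting algebra is $\langle\mathbf{H},\square,\Diamond\rangle$ with $\mathbf{H}$ a Heyting algebra (implication $\rightharpoonup$, $-a=a\rightharpoonup\bot$) and unary $\square,\Diamond$ satisfying $\square a\wedge\Diamond(-a\wedge b)=\bot$. A Boolean filter is a filter containing all dense elements ($--a=\top$). $\mathbf{N}(\mathbf{M},F)$ is the twist structure on $\{(x,y)\in H\times H: x\wedge y=\bot,\ x\vee y\in F\}$ with $(x,y)\vee(s,t)=(x\vee s,y\wedge t)$, $(x,y)\wedge(s,t)=(x\wedge s,y\vee t)$, $(x,y)*(s,t)=(x\wedge s,(x\rightharpoonup t)\wedge(s\rightharpoonup y))$, $(x,y)\Rightarrow(s,t)=((x\rightharpoonup s)\wedge(t\rightharpoonup y),x\wedge t)$, $\top=(\top,\bot)$, $\bot=(\bot,\top)$, $\sim(x,y)=(y,x)$, and modal operators $\blacksquare(x,y)=(\square x,\Diamond y)$, $\Diamond_N(x,y)=(\Diamond x,\square y)$ (here $\Diamond_N$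 denotes the Nelson-level diamond, written as a black lozenge in the paper); it is a modal Nelson lattice. For a modal Nelson lattice $\mathbf{N}=\langle\mathbf{A},\blacksquare,\Diamond_N\rangle$ (with $a^2=a*a$), $\mathbf{H}^*$ is the Heyting algebra on $H^*=\{a\in A:a^2=a\}$ with $a\vee^*b=(a\vee b)^2$, $a\wedge^*b=(a\wedge b)^2$, $a\rightharpoonup^*b=(a^2\Rightarrow b)^2$; $\square^*a=(\blacksquare a)^2$, $\Diamond^*a=(\Diamond_N a)^2$; and $F^*=\{(a\vee\sim a)^2:a\in A\}$. -}

module Defs where

open import Level using (Level; _⊔_; suc)
open import Data.Product using (_×_; _,_; proj₁; proj₂; Σ; ∃)
open import Relation.Binary.Lattice.Bundles using (HeytingAlgebra)

record ModalHeytingAlgebra c ℓ₁ ℓ₂ : Set (suc (c ⊔ ℓ₁ ⊔ ℓ₂)) where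
  field
    heyting : HeytingAlgebra c ℓ₁ ℓ₂
  open HeytingAlgebra heyting public
  field
    □ : Carrier → Carrier
    ◇ : Carrier → Carrier
    □-cong : ∀ {a b} → a ≈ b → □ a ≈ □ b
    ◇-cong : ∀ {a b} → a ≈ b → ◇ a ≈ ◇ b

  -_ : Carrier → Carrier
  - a = a ⇨ ⊥

  field
    modal-axiom : ∀ a b → (□ a ∧ ◇ ((- a) ∧ b)) ≈ ⊥

module _ {c ℓ₁ ℓ₂} (M : ModalHeytingAlgebra c ℓ₁ ℓ₂) where
  open ModalHeytingAlgebra M

  record IsFilter {ℓ} (F : Carrier → Set ℓ) : Set (c ⊔ ℓ₂ ⊔ ℓ) where
    field
      ⊤∈F    : F ⊤
      ∧-closed : ∀ {a b} → F a → F b → F (a ∧ b)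
      up-closed : ∀ {a b} → a ≤ b → F a → F b

  record IsBooleanFilter {ℓ} (F : Carrier → Set ℓ) : Set (c ⊔ ℓ₁ ⊔ ℓ₂ ⊔ ℓ) where
    field
      isFilter : IsFilter F
      dense∈F  : ∀ a → (- (- a)) ≈ ⊤ → F a

-- The operations are defined on raw pairs; membership in
-- N(M,F) is the predicate InN.

module Twist {c ℓ₁ ℓ₂ ℓ} (M : ModalHeytingAlgebra c ℓ₁ ℓ₂)
             (F : ModalHeytingAlgebra.Carrier M → Set ℓ) where
  open ModalHeytingAlgebra M

  Pair : Set c
  Pair = Carrier × Carrier

  InN : Pair → Set (ℓ₁ ⊔ ℓ)
  InN (x , y) = ((x ∧ y) ≈ ⊥) × F (x ∨ y)

  infix 4 _≈N_
  _≈N_ : Pair → Pair → Set ℓ₁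
  (x , y) ≈N (s , t) = (x ≈ s) × (y ≈ t)

  _∨N_ _∧N_ _*N_ _⇒N_ : Pair → Pair → Pair
  (x , y) ∨N (s , t) = (x ∨ s , y ∧ t)
  (x , y) ∧N (s , t) = (x ∧ s , y ∨ t)
  (x , y) *N (s , t) = (x ∧ s , (x ⇨ t) ∧ (s ⇨ y))
  (x , y) ⇒N (s , t) = ((x ⇨ s) ∧ (t ⇨ y) , x ∧ t)

  ⊤N ⊥N : Pair
  ⊤N = (⊤ , ⊥)
  ⊥N = (⊥ , ⊤)

  ∼N_ : Pair → Pair
  ∼N (x , y) = (y , x)

  ■N ◆N : Pair → Pair
  ■N (x , y) = (□ x , ◇ y)
  ◆N (x , y) = (◇ x , □ y)

  sq : Pair → Pair
  sq a = a *N a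

  InH* : Pair → Set (ℓ₁ ⊔ ℓ)
  InH* a = InN a × (sq a ≈N a)

  _∨*_ _∧*_ _⇀*_ : Pair → Pair → Pair
  a ∨* b = sq (a ∨N b)
  a ∧* b = sq (a ∧N b)
  a ⇀* b = sq (sq a ⇒N b)

  □* ◇* : Pair → Pair
  □* a = sq (■N a)
  ◇* a = sq (◆N a)

  InF* : Pair → Set (c ⊔ ℓ₁ ⊔ ℓ)
  InF* z = Σ Pair λ a → InN a × (sq (a ∨N (∼N a)) ≈N z)

  h : Carrier → Pair
  h a = (a , - a)

{-# OPTIONS --safe #-}
-- A twist pair (x , y) with x ∧ y = ⊥ has y ≤ - x, and squaring it yields
-- (x , x ⇨ y) = (x , - x) = h x.  So squaring retracts N(M,F) onto the image
-- of h, which is therefore exactly H*, and each operation of M* is h of the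
-- corresponding operation of M as soon as the second component of the twist
-- operation lies below the negation of the first: this is De Morgan for ∨
-- and ∧, contraposition for ⇨, and the modal axiom for ■ and ◆.  Finally
-- (x , y) ∨ ∼(x , y) = (x ∨ y , y ∧ x) squares to h (x ∨ y), so F* = h[F].
module Submission where

open import Defs
open import Data.Product using (_×_; _,_; Σ; proj₁)
open import Data.Product.Relation.Binary.Pointwise.NonDependent using (_×ₛ_)
open import Function.Bundles using (_⇔_; mk⇔)
open import Relation.Binary.Lattice.Bundles using (HeytingAlgebra)
open import Relation.Binary.Bundles using (Setoid)
import Relation.Binary.Reasoning.Setoid as SetoidReasoning

module HeytingNegation {c ℓ₁ ℓ₂} (H : HeytingAlgebra c ℓ₁ ℓ₂) where
  open HeytingAlgebra H
  open import Relation.Binary.Lattice.Properties.HeytingAlgebra H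
    using (¬_; ⇨-eval; ⇨-applyʳ; ⇨ʳ-covariant; ⇨-cong; ⇨-unit; ⇨ˡ-contravariant; weak-lem)
  open import Relation.Binary.Lattice.Properties.JoinSemilattice joinSemilattice
    using (∨-comm)
  open import Relation.Binary.Lattice.Properties.MeetSemilattice meetSemilattice
    using (∧-comm)

  x≤⊥⇒x≈⊥ : ∀ {x} → x ≤ ⊥ → x ≈ ⊥
  x≤⊥⇒x≈⊥ x≤⊥ = antisym x≤⊥ (minimum _)

  x∧y≤⊥⇒y≤¬x : ∀ {x y} → x ∧ y ≤ ⊥ → y ≤ ¬ x
  x∧y≤⊥⇒y≤¬x x∧y≤⊥ = transpose-⇨ (trans (reflexive (∧-comm _ _)) x∧y≤⊥)

  x∧¬x≤⊥ : ∀ x → x ∧ ¬ x ≤ ⊥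
  x∧¬x≤⊥ x = ⇨-applyʳ refl

  w≤x⇨y⇒w≤x⇒w≤y : ∀ {w x y} → w ≤ x ⇨ y → w ≤ x → w ≤ y
  w≤x⇨y⇒w≤x⇒w≤y w≤x⇨y w≤x = trans (∧-greatest w≤x⇨y w≤x) ⇨-eval

  w≤x⇒w≤¬x⇒w≤⊥ : ∀ {w x} → w ≤ x → w ≤ ¬ x → w ≤ ⊥
  w≤x⇒w≤¬x⇒w≤⊥ w≤x w≤¬x = trans (∧-greatest w≤x w≤¬x) (x∧¬x≤⊥ _)

  y≤¬x⇒x⇨y≈¬x : ∀ {x y} → y ≤ ¬ x → x ⇨ y ≈ ¬ x
  y≤¬x⇒x⇨y≈¬x {y = y} y≤¬x = antisym
    (transpose-⇨ (trans (∧-greatest ⇨-eval (x∧y≤y _ _)) (transpose-∧ y≤¬x)))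
    (⇨ʳ-covariant (minimum y))

  x⇨y≤¬y⇨¬x : ∀ x y → x ⇨ y ≤ ¬ y ⇨ ¬ x
  x⇨y≤¬y⇨¬x x y = transpose-⇨ (transpose-⇨ (w≤x⇒w≤¬x⇒w≤⊥
    (w≤x⇨y⇒w≤x⇒w≤y (trans (x∧y≤x _ _) (x∧y≤x _ _)) (x∧y≤y _ _))
    (trans (x∧y≤x _ _) (x∧y≤y _ _))))

  x∧¬y≤¬[x⇨y] : ∀ x y → x ∧ ¬ y ≤ ¬ (x ⇨ y)
  x∧¬y≤¬[x⇨y] x y = transpose-⇨ (w≤x⇒w≤¬x⇒w≤⊥
    (w≤x⇨y⇒w≤x⇒w≤y (x∧y≤y _ _) (trans (x∧y≤x _ _) (x∧y≤x _ _)))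
    (trans (x∧y≤x _ _) (x∧y≤y _ _)))

  ¬x∨¬y≤¬[x∧y] : ∀ x y → ¬ x ∨ ¬ y ≤ ¬ (x ∧ y)
  ¬x∨¬y≤¬[x∧y] x y =
    ∨-least (⇨ˡ-contravariant (x∧y≤x x y)) (⇨ˡ-contravariant (x∧y≤y x y))

  ¬⊤≈⊥ : ¬ ⊤ ≈ ⊥
  ¬⊤≈⊥ = x≤⊥⇒x≈⊥ (trans (∧-greatest refl (maximum _)) ⇨-eval)

  ¬⊥≈⊤ : ¬ ⊥ ≈ ⊤
  ¬⊥≈⊤ = ⇨-unit

  ¬¬[x∨¬x]≈⊤ : ∀ x → ¬ ¬ (x ∨ ¬ x) ≈ ⊤
  ¬¬[x∨¬x]≈⊤ x = Eq.trans (⇨-cong (⇨-cong (∨-comm _ _) Eq.refl) Eq.refl) weak-lem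

module ModalProperties {c ℓ₁ ℓ₂} (M : ModalHeytingAlgebra c ℓ₁ ℓ₂) where
  open ModalHeytingAlgebra M
  open HeytingNegation heyting
  open import Relation.Binary.Lattice.Properties.HeytingAlgebra heyting
    using (x≤¬¬x)
  open import Relation.Binary.Lattice.Properties.MeetSemilattice meetSemilattice
    using (∧-cong; y≤x⇒x∧y≈y)
  open import Relation.Binary.Lattice.Properties.BoundedMeetSemilattice boundedMeetSemilattice
    using () renaming (identityʳ to ∧-identityʳ)

  ◇¬≤¬□ : ∀ a → ◇ (- a) ≤ - □ a
  ◇¬≤¬□ a = x∧y≤⊥⇒y≤¬x (reflexive (Eq.trans
    (∧-cong Eq.refl (◇-cong (Eq.sym (∧-identityʳ (- a)))))
    (modal-axiom a ⊤)))

  □¬≤¬◇ : ∀ a → □ (- a) ≤ - ◇ a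
  □¬≤¬◇ a = transpose-⇨ (reflexive (Eq.trans
    (∧-cong Eq.refl (◇-cong (Eq.sym (y≤x⇒x∧y≈y (x≤¬¬x a)))))
    (modal-axiom (- a) a)))

module TwistProperties {c ℓ₁ ℓ₂ ℓ} (M : ModalHeytingAlgebra c ℓ₁ ℓ₂)
                       (F : ModalHeytingAlgebra.Carrier M → Set ℓ) where
  open ModalHeytingAlgebra M
  open Twist M F
  open HeytingNegation heyting
  open ModalProperties M
  open import Relation.Binary.Lattice.Properties.HeytingAlgebra heyting
    using (⇨-cong; de-morgan₁)
  open import Relation.Binary.Lattice.Properties.MeetSemilattice meetSemilattice
    using (∧-comm; ∧-cong; ∧-idempotent; y≤x⇒x∧y≈y)
  open import Relation.Binary.Lattice.Properties.BoundedJoinSemilattice boundedJoinSemilattice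
    using () renaming (identityʳ to ∨-identityʳ)
  open SetoidReasoning (setoid ×ₛ setoid)
  open Setoid (setoid ×ₛ setoid) using () renaming (sym to ≈N-sym; trans to ≈N-trans)

  sq≈h : ∀ {x y a} → x ≈ a → y ≤ - a → sq (x , y) ≈N h a
  sq≈h x≈a y≤-a =
    Eq.trans (∧-idempotent _) x≈a ,
    Eq.trans (∧-idempotent _) (Eq.trans (⇨-cong x≈a Eq.refl) (y≤¬x⇒x⇨y≈¬x y≤-a))

  sq-cong : ∀ {p q} → p ≈N q → sq p ≈N sq q
  sq-cong (x≈s , y≈t) = ∧-cong x≈s x≈s , ∧-cong (⇨-cong x≈s y≈t) (⇨-cong x≈s y≈t)

  ⇒N-congˡ : ∀ {p q r} → p ≈N q → (p ⇒N r) ≈N (q ⇒N r)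
  ⇒N-congˡ (x≈s , y≈t) = ∧-cong (⇨-cong x≈s Eq.refl) (⇨-cong Eq.refl y≈t) , ∧-cong x≈s Eq.refl

  sq[h]≈h : ∀ a → sq (h a) ≈N h a
  sq[h]≈h a = sq≈h Eq.refl refl

  h-surjective-H* : ∀ z → InH* z → Σ Carrier λ a → h a ≈N z
  h-surjective-H* (x , y) ((x∧y≈⊥ , _) , sq-z≈z) = x , (begin
    h x         ≈⟨ sq≈h Eq.refl (x∧y≤⊥⇒y≤¬x (reflexive x∧y≈⊥)) ⟨
    sq (x , y)  ≈⟨ sq-z≈z ⟩
    (x , y)     ∎)

  h-∨ : ∀ a b → h (a ∨ b) ≈N (h a ∨* h b)
  h-∨ a b = ≈N-sym (sq≈h Eq.refl (reflexive (Eq.sym (de-morgan₁ a b))))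

  h-∧ : ∀ a b → h (a ∧ b) ≈N (h a ∧* h b)
  h-∧ a b = ≈N-sym (sq≈h Eq.refl (¬x∨¬y≤¬[x∧y] a b))

  h-⇨ : ∀ a b → h (a ⇨ b) ≈N (h a ⇀* h b)
  h-⇨ a b = begin
    h (a ⇨ b)             ≈⟨ sq≈h contraposition-absorbed (x∧¬y≤¬[x⇨y] a b) ⟨
    sq (h a ⇒N h b)       ≈⟨ sq-cong (⇒N-congˡ (sq[h]≈h a)) ⟨
    sq (sq (h a) ⇒N h b)  ∎
    where
    contraposition-absorbed : (a ⇨ b) ∧ (- b ⇨ - a) ≈ a ⇨ b
    contraposition-absorbed = Eq.trans (∧-comm _ _) (y≤x⇒x∧y≈y (x⇨y≤¬y⇨¬x a b))

  h-⊤ : h ⊤ ≈N ⊤N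
  h-⊤ = Eq.refl , ¬⊤≈⊥

  h-⊥ : h ⊥ ≈N ⊥N
  h-⊥ = Eq.refl , ¬⊥≈⊤

  h-□ : ∀ a → h (□ a) ≈N □* (h a)
  h-□ a = ≈N-sym (sq≈h Eq.refl (◇¬≤¬□ a))

  h-◇ : ∀ a → h (◇ a) ≈N ◇* (h a)
  h-◇ a = ≈N-sym (sq≈h Eq.refl (□¬≤¬◇ a))

  module _ (isBooleanFilter : IsBooleanFilter M F) where
    open IsBooleanFilter isBooleanFilter
    open IsFilter isFilter

    h∈H* : ∀ a → InH* (h a)
    h∈H* a = (x≤⊥⇒x≈⊥ (x∧¬x≤⊥ a) , dense∈F _ (¬¬[x∨¬x]≈⊤ a)) , sq[h]≈h a

    h[F]⊆F* : ∀ z → Σ Carrier (λ a → F a × (h a ≈N z)) → InF* z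
    h[F]⊆F* z (a , a∈F , ha≈z) =
      (a , ⊥) , (y≤x⇒x∧y≈y (minimum a) , up-closed (x≤x∨y a ⊥) a∈F) ,
      ≈N-trans (sq≈h (∨-identityʳ a) (trans (x∧y≤x ⊥ a) (minimum _))) ha≈z

    F*⊆h[F] : ∀ z → InF* z → Σ Carrier λ a → F a × (h a ≈N z)
    F*⊆h[F] _ ((x , y) , (x∧y≈⊥ , x∨y∈F) , sq≈z) =
      x ∨ y , x∨y∈F ,
      ≈N-trans (≈N-sym (sq≈h Eq.refl y∧x≤-[x∨y])) sq≈z
      where
      y∧x≤-[x∨y] : y ∧ x ≤ - (x ∨ y)
      y∧x≤-[x∨y] = trans (reflexive (Eq.trans (∧-comm y x) x∧y≈⊥)) (minimum _)

    h[F]⇔F* : ∀ z → (Σ Carrier λ a → F a × (h a ≈N z)) ⇔ InF* z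
    h[F]⇔F* z = mk⇔ (h[F]⊆F* z) (F*⊆h[F] z)

theorem5 : ∀ {c ℓ₁ ℓ₂ ℓ} (M : ModalHeytingAlgebra c ℓ₁ ℓ₂)
  (F : ModalHeytingAlgebra.Carrier M → Set ℓ) →
  IsBooleanFilter M F →
  (let open ModalHeytingAlgebra M in
    ∀ a b → (a ∧ b) ≈ ⊥ → F (a ∨ b) → F (□ a ∨ ◇ b)) →
  let open ModalHeytingAlgebra M
      open Twist M F
  in
  -- h maps H into H*
  (∀ a → InH* (h a))
  -- h is injective and onto H*
  × (∀ a b → h a ≈N h b → a ≈ b)
  × (∀ z → InH* z → Σ Carrier λ a → h a ≈N z)
  -- h is a homomorphism of modal Heyting algebras M → M*
  × (∀ a b → h (a ∨ b) ≈N (h a ∨* h b))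
  × (∀ a b → h (a ∧ b) ≈N (h a ∧* h b))
  × (∀ a b → h (a ⇨ b) ≈N (h a ⇀* h b))
  × (h ⊤ ≈N ⊤N)
  × (h ⊥ ≈N ⊥N)
  × (∀ a → h (□ a) ≈N □* (h a))
  × (∀ a → h (◇ a) ≈N ◇* (h a))
  -- h[F] = F*
  × (∀ z → (Σ Carrier λ a → F a × (h a ≈N z)) ⇔ InF* z)
-- The hypothesis on □ a ∨ ◇ b only makes N(M,F) closed under ■ and ◆;
-- none of the facts proved here depend on it.
theorem5 M F isBooleanFilter _ =
  h∈H* isBooleanFilter , (λ _ _ → proj₁) , h-surjective-H* ,
  h-∨ , h-∧ , h-⇨ , h-⊤ , h-⊥ , h-□ , h-◇ , h[F]⇔F* isBooleanFilter
  where open TwistProperties M F
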